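{- Let $G=(V,E)$ be a finite simple graph with vertices $v_1,\dots,v_n$, let $O$ be an orientation of $G$, and let $D:E\to\mathbb{N}$ assign a positive integer (strength) to every edge, so that $(G,D,O)$ is an augmented orientation. Let $k$ be the maximum augmented in-degree of a vertex in $(G,D,O)$. If the number of even Eulerian structures in $(G,D,O)$ is different from the number of odd Eulerian structures in $(G,D,O)$, then \[ AT(G)-1=\alpha(f_G)\le \alpha(W_{G,D})\le k . \]
   Context: For a nonzero polynomial $Q$ (with integer coefficients), $\alpha(Q)$ is the minimum $k$ such that some monomial $m$ occurring in $Q$ with nonzero coefficient satisfies $\deg(m)=\deg(Q)$ and every variable has degree at most $k$ in $m$. The graph polynomial is $f_G(x_1,\dots,x_n)=\prod_{i<j,\ \{v_i,v_j\}\in E}(x_i-x_j)$, and the Alon–Tarsi number is $AT(G)=\alpha(f_G)+1$. For strengths $D$, $W_{G,D}(x_1,\dots,x_n)=\prod_{i<j,\ e=\{v_i,v_j\}\in E}(x_i^{D(e)}-x_j^{D(e)})$. The augmented in-degree (out-degree) of a vertex is the sum of strengths of its ingoing (outgoing) edges. An Eulerian structure in $(G,D,O)$ is a subgraph $F$ of $G$ without isolated vertices such that every vertex of $F$ has augmented in-degree equal to its augmented out-degree in $F$, with the orientation $O$ and strengths $D$ restricted to $F$ (the empty subgraph counts). A graph is even (odd) if its number of edges is even (odd). -}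

module Defs where

open import Data.Nat using (ℕ; zero; suc; _+_; _≤_; _⊔_; _⊓_; _∸_; _%_)
import Data.Nat.Properties as ℕP
open import Data.Integer as ℤ using (ℤ; 0ℤ; 1ℤ)
import Data.Integer.Properties as ℤP
open import Data.Fin as Fin using (Fin; toℕ)
import Data.Fin.Properties as FinP
open import Data.Fin.Subset using (Subset; inside; outside; ⊤; ∣_∣)
open import Data.Vec as Vec using (Vec; []; _∷_)
import Data.Vec.Properties as VecP
open import Data.List as List using (List; []; _∷_; _++_; filter; length)
open import Data.Nat.ListAction using (sum)
open import Data.Bool using (Bool; true; false; if_then_else_; _∧_)
open import Data.Product using (_×_; _,_; proj₁; proj₂)
open import Relation.Nullary using (Dec; ¬_; ¬?; does)
open import Relation.Nullary.Decidable using (_×-dec_)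
open import Relation.Binary.PropositionalEquality using (_≡_)

Monomial : ℕ → Set
Monomial n = Vec ℕ n

-- A polynomial is a finite formal sum  Σ a·m  (terms need not be
-- normalised; the coefficient of m is obtained by adding up all terms
-- whose monomial is m).
Poly : ℕ → Set
Poly n = List (ℤ × Monomial n)

oneP : ∀ {n} → Poly n
oneP {n} = (1ℤ , Vec.replicate n 0) ∷ []

varPow : ∀ {n} → Fin n → ℕ → Poly n
varPow i d = (1ℤ , Vec.tabulate (λ j → if does (i Fin.≟ j) then d else 0)) ∷ []

_-P_ : ∀ {n} → Poly n → Poly n → Poly n
p -P q = p ++ List.map (λ t → (ℤ.- proj₁ t , proj₂ t)) q

_*P_ : ∀ {n} → Poly n → Poly n → Poly n
p *P q = List.concatMap
  (λ t → List.map (λ s → (proj₁ t ℤ.* proj₁ s , Vec.zipWith _+_ (proj₂ t) (proj₂ s))) q) p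

prodP : ∀ {n} → List (Poly n) → Poly n
prodP = List.foldr _*P_ oneP

coeff : ∀ {n} → Poly n → Monomial n → ℤ
coeff [] m = 0ℤ
coeff ((a , m') ∷ p) m =
  if does (VecP.≡-dec ℕP._≟_ m' m) then a ℤ.+ coeff p m else coeff p m

support : ∀ {n} → Poly n → List (Monomial n)
support p = filter (λ m → ¬? (coeff p m ℤ.≟ 0ℤ)) (List.map proj₂ p)

degM : ∀ {n} → Monomial n → ℕ
degM = Vec.foldr _ _+_ 0

maxExp : ∀ {n} → Monomial n → ℕ
maxExp = Vec.foldr _ _⊔_ 0

-- degree of a polynomial (only meaningful for nonzero polynomials)
degP : ∀ {n} → Poly n → ℕ
degP p = List.foldr _⊔_ 0 (List.map degM (support p))

minList : List ℕ → ℕ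
minList [] = 0
minList (x ∷ []) = x
minList (x ∷ y ∷ xs) = x ⊓ minList (y ∷ xs)

-- α(Q): the minimum, over monomials m of Q with nonzero coefficient and
-- deg m = deg Q, of the largest exponent of a variable in m.
-- (Only meaningful for nonzero Q; convention α(0) = 0.)
α : ∀ {n} → Poly n → ℕ
α p = minList (List.map maxExp
        (filter (λ m → degM m ℕP.≟ degP p) (support p)))

record SimpleGraph (n : ℕ) : Set where
  field
    m      : ℕ
    endA   : Fin m → Fin n
    endB   : Fin m → Fin n
    ordered : ∀ e → endA e Fin.< endB e
    simple : ∀ e e' → endA e ≡ endA e' → endB e ≡ endB e' → e ≡ e'
open SimpleGraph public

edges : ∀ {n} (G : SimpleGraph n) → List (Fin (m G))
edges G = List.allFin (m G)

-- orientation: O e = true means e is oriented endA e → endB e,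
-- O e = false means endB e → endA e.
Orientation : ∀ {n} → SimpleGraph n → Set
Orientation G = Fin (m G) → Bool

-- strengths D : E → ℕ  (positivity is a separate hypothesis)
Strength : ∀ {n} → SimpleGraph n → Set
Strength G = Fin (m G) → ℕ

tailV headV : ∀ {n} (G : SimpleGraph n) → Orientation G → Fin (m G) → Fin n
tailV G O e = if O e then endA G e else endB G e
headV G O e = if O e then endB G e else endA G e

fG : ∀ {n} → SimpleGraph n → Poly n
fG G = prodP (List.map (λ e → varPow (endA G e) 1 -P varPow (endB G e) 1) (edges G))

W : ∀ {n} (G : SimpleGraph n) → Strength G → Poly n
W G D = prodP (List.map (λ e → varPow (endA G e) (D e) -P varPow (endB G e) (D e)) (edges G))

AT : ∀ {n} → SimpleGraph n → ℕ
AT G = α (fG G) + 1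

-- A subgraph without isolated vertices is determined by its edge set,
-- so Eulerian structures are represented by edge subsets S ⊆ E.
inS : ∀ {k} → Subset k → Fin k → Bool
inS S e = Vec.lookup S e

sumE : ∀ {n} (G : SimpleGraph n) → (Fin (m G) → ℕ) → ℕ
sumE G f = sum (List.map f (edges G))

augIn augOut : ∀ {n} (G : SimpleGraph n) → Strength G → Orientation G →
               Subset (m G) → Fin n → ℕ
augIn G D O S v =
  sumE G (λ e → if inS S e ∧ does (headV G O e Fin.≟ v) then D e else 0)
augOut G D O S v =
  sumE G (λ e → if inS S e ∧ does (tailV G O e Fin.≟ v) then D e else 0)

IsEulerian : ∀ {n} (G : SimpleGraph n) → Strength G → Orientation G →
             Subset (m G) → Set
IsEulerian G D O S = ∀ v → augIn G D O S v ≡ augOut G D O S v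

isEulerian? : ∀ {n} (G : SimpleGraph n) (D : Strength G) (O : Orientation G)
              (S : Subset (m G)) → Dec (IsEulerian G D O S)
isEulerian? G D O S = FinP.all? (λ v → augIn G D O S v ℕP.≟ augOut G D O S v)

allSubsets : ∀ k → List (Subset k)
allSubsets zero = Vec.[] ∷ []
allSubsets (suc k) = List.map (inside Vec.∷_) (allSubsets k)
                  ++ List.map (outside Vec.∷_) (allSubsets k)

numEvenES numOddES : ∀ {n} (G : SimpleGraph n) → Strength G → Orientation G → ℕ
numEvenES G D O = length (filter (λ S → isEulerian? G D O S ×-dec (∣ S ∣ % 2 ℕP.≟ 0))
                                 (allSubsets (m G)))
numOddES G D O = length (filter (λ S → isEulerian? G D O S ×-dec (∣ S ∣ % 2 ℕP.≟ 1))
                                (allSubsets (m G)))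

maxAugIn : ∀ {n} (G : SimpleGraph n) → Strength G → Orientation G → ℕ
maxAugIn {n} G D O = List.foldr _⊔_ 0 (List.map (augIn G D O ⊤) (List.allFin n))

-- Each factor x_A^D − x_B^D of W is (x_A − x_B)·(x_A^(D−1) + x_A^(D−2) x_B + … + x_B^(D−1)), so every
-- monomial of W with nonzero coefficient is a monomial of f_G times some monomial; multiplying can
-- only raise the largest exponent, and both polynomials are homogeneous, whence α(f_G) ≤ α(W).
-- Expanding W by choosing, edge by edge, the tail term or the head term, the choice set S gives the
-- monomial x^(indeg) of all augmented in-degrees exactly when S is Eulerian, and then with sign
-- ±(−1)^|S| (the ± depends only on O). So that monomial has coefficient ±(#even − #odd) ≠ 0 and
-- α(W) is at most its largest exponent, the maximum augmented in-degree.

module Submission where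

open import Defs
open import Data.Bool using (Bool; true; false; if_then_else_; _∧_)
open import Data.Empty using (⊥-elim)
open import Data.Fin as Fin using (Fin)
open import Data.Fin.Subset using (Subset; inside; outside; ⊤; ⊥; ∣_∣)
open import Data.Integer as ℤ
  using (ℤ; 0ℤ; 1ℤ; -1ℤ; _^_) renaming (_+_ to _+ℤ_; _*_ to _*ℤ_; _-_ to _-ℤ_)
import Data.Integer.Properties as ℤP
open import Data.Integer.Tactic.RingSolver using (solve-∀)
open import Data.List as List using (List; []; _∷_; _++_)
import Data.List.Properties as ListP
open import Data.List.Membership.Propositional using (_∈_)
import Data.List.Membership.Propositional.Properties as ∈P
open import Data.List.Relation.Unary.All as All using (All; []; _∷_)
import Data.List.Relation.Unary.All.Properties as AllP
open import Data.List.Relation.Unary.Any using (here; there)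
open import Data.Nat using (ℕ; zero; suc; _+_; _≤_; _⊔_; _∸_; _%_)
import Data.Nat.Properties as ℕP
open import Data.Nat.ListAction using (sum)
import Data.Nat.Tactic.RingSolver as ℕSolver
open import Data.Product using (∃-syntax; _×_; _,_; proj₁; proj₂)
open import Data.Sum using (inj₁; inj₂)
open import Data.Vec as Vec using ([]; _∷_)
import Data.Vec.Properties as VecP
open import Function using (_∘_; _⇔_; mk⇔)
open import Relation.Nullary using (Dec; yes; no; does; ¬?)
open import Relation.Nullary.Decidable using (_×-dec_; does-⇔)
open import Relation.Binary.PropositionalEquality
  using (_≡_; _≢_; refl; sym; trans; cong; cong₂; subst; _≗_; module ≡-Reasoning)

private
  variable
    n : ℕ

infixl 7 _*ᴹ_

_*ᴹ_ : Monomial n → Monomial n → Monomial n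
_*ᴹ_ = Vec.zipWith _+_

1ᴹ : Monomial n
1ᴹ {n} = Vec.replicate n 0

x[_]^_ : Fin n → ℕ → Monomial n
x[ i ]^ d = Vec.tabulate (λ j → if does (i Fin.≟ j) then d else 0)

infix 4 _≟ᴹ_

_≟ᴹ_ : (m m' : Monomial n) → Dec (m ≡ m')
_≟ᴹ_ = VecP.≡-dec ℕP._≟_

≗-lookup⇒≡ : {u w : Monomial n} → Vec.lookup u ≗ Vec.lookup w → u ≡ w
≗-lookup⇒≡ {u = u} {w} eq =
  trans (sym (VecP.tabulate∘lookup u)) (trans (VecP.tabulate-cong eq) (VecP.tabulate∘lookup w))

lookup-*ᴹ : (u w : Monomial n) (v : Fin n) →
            Vec.lookup (u *ᴹ w) v ≡ Vec.lookup u v + Vec.lookup w v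
lookup-*ᴹ u w v = VecP.lookup-zipWith _+_ v u w

*ᴹ-assoc : (u v w : Monomial n) → (u *ᴹ v) *ᴹ w ≡ u *ᴹ (v *ᴹ w)
*ᴹ-assoc = VecP.zipWith-assoc ℕP.+-assoc

*ᴹ-comm : (u w : Monomial n) → u *ᴹ w ≡ w *ᴹ u
*ᴹ-comm = VecP.zipWith-comm ℕP.+-comm

*ᴹ-identityˡ : (m : Monomial n) → 1ᴹ *ᴹ m ≡ m
*ᴹ-identityˡ = VecP.zipWith-identityˡ ℕP.+-identityˡ

*ᴹ-cancelˡ : (h u w : Monomial n) → h *ᴹ u ≡ h *ᴹ w → u ≡ w
*ᴹ-cancelˡ h u w eq = ≗-lookup⇒≡ λ v → ℕP.+-cancelˡ-≡ (Vec.lookup h v) _ _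
  (trans (sym (lookup-*ᴹ h u v)) (trans (cong (λ z → Vec.lookup z v) eq) (lookup-*ᴹ h w v)))

*ᴹ-interchange : (u v w z : Monomial n) → (u *ᴹ v) *ᴹ (w *ᴹ z) ≡ (u *ᴹ w) *ᴹ (v *ᴹ z)
*ᴹ-interchange u v w z = begin
  (u *ᴹ v) *ᴹ (w *ᴹ z)  ≡⟨ *ᴹ-assoc u v (w *ᴹ z) ⟩
  u *ᴹ (v *ᴹ (w *ᴹ z))  ≡⟨ cong (u *ᴹ_) (sym (*ᴹ-assoc v w z)) ⟩
  u *ᴹ ((v *ᴹ w) *ᴹ z)  ≡⟨ cong (λ t → u *ᴹ (t *ᴹ z)) (*ᴹ-comm v w) ⟩
  u *ᴹ ((w *ᴹ v) *ᴹ z)  ≡⟨ cong (u *ᴹ_) (*ᴹ-assoc w v z) ⟩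
  u *ᴹ (w *ᴹ (v *ᴹ z))  ≡⟨ sym (*ᴹ-assoc u w (v *ᴹ z)) ⟩
  (u *ᴹ w) *ᴹ (v *ᴹ z)  ∎
  where open ≡-Reasoning

lookup-x^ : (i : Fin n) (d : ℕ) (v : Fin n) →
            Vec.lookup (x[ i ]^ d) v ≡ (if does (i Fin.≟ v) then d else 0)
lookup-x^ i d v = VecP.lookup∘tabulate _ v

x^-*ᴹ : (i : Fin n) (a b : ℕ) → x[ i ]^ a *ᴹ x[ i ]^ b ≡ x[ i ]^ (a + b)
x^-*ᴹ i a b = ≗-lookup⇒≡ λ v → begin
  Vec.lookup (x[ i ]^ a *ᴹ x[ i ]^ b) v
    ≡⟨ lookup-*ᴹ (x[ i ]^ a) (x[ i ]^ b) v ⟩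
  Vec.lookup (x[ i ]^ a) v + Vec.lookup (x[ i ]^ b) v
    ≡⟨ cong₂ _+_ (lookup-x^ i a v) (lookup-x^ i b v) ⟩
  (if does (i Fin.≟ v) then a else 0) + (if does (i Fin.≟ v) then b else 0)
    ≡⟨ if-+ (does (i Fin.≟ v)) ⟩
  (if does (i Fin.≟ v) then a + b else 0)
    ≡⟨ sym (lookup-x^ i (a + b) v) ⟩
  Vec.lookup (x[ i ]^ (a + b)) v ∎
  where
  open ≡-Reasoning
  if-+ : ∀ c → (if c then a else 0) + (if c then b else 0) ≡ (if c then a + b else 0)
  if-+ true  = refl
  if-+ false = refl

x^0≡1ᴹ : (i : Fin n) → x[ i ]^ 0 ≡ 1ᴹ
x^0≡1ᴹ i = ≗-lookup⇒≡ λ v →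
  trans (lookup-x^ i 0 v) (trans (if-0 (does (i Fin.≟ v))) (sym (VecP.lookup-replicate v 0)))
  where
  if-0 : ∀ c → (if c then 0 else 0) ≡ 0
  if-0 true  = refl
  if-0 false = refl

∑ : {X : Set} → List X → (X → ℤ) → ℤ
∑ xs f = List.foldr (λ x acc → f x +ℤ acc) 0ℤ xs

∑-cong : {X : Set} {f g : X → ℤ} (xs : List X) → (∀ x → f x ≡ g x) → ∑ xs f ≡ ∑ xs g
∑-cong []       eq = refl
∑-cong (x ∷ xs) eq = cong₂ _+ℤ_ (eq x) (∑-cong xs eq)

∑-++ : {X : Set} (xs ys : List X) (f : X → ℤ) → ∑ (xs ++ ys) f ≡ ∑ xs f +ℤ ∑ ys f
∑-++ []       ys f = sym (ℤP.+-identityˡ _)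
∑-++ (x ∷ xs) ys f = trans (cong (f x +ℤ_) (∑-++ xs ys f)) (sym (ℤP.+-assoc (f x) _ _))

∑-map : {X Y : Set} (g : X → Y) (xs : List X) (f : Y → ℤ) → ∑ (List.map g xs) f ≡ ∑ xs (f ∘ g)
∑-map g []       f = refl
∑-map g (x ∷ xs) f = cong (f (g x) +ℤ_) (∑-map g xs f)

∑-concatMap : {X Y : Set} (g : X → List Y) (xs : List X) (f : Y → ℤ) →
              ∑ (List.concatMap g xs) f ≡ ∑ xs (λ x → ∑ (g x) f)
∑-concatMap g []       f = refl
∑-concatMap g (x ∷ xs) f = trans (∑-++ (g x) _ f) (cong (∑ (g x) f +ℤ_) (∑-concatMap g xs f))

∑-*ˡ : {X : Set} (c : ℤ) (xs : List X) (f : X → ℤ) → ∑ xs (λ x → c *ℤ f x) ≡ c *ℤ ∑ xs f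
∑-*ˡ c []       f = sym (ℤP.*-zeroʳ c)
∑-*ˡ c (x ∷ xs) f = trans (cong (c *ℤ f x +ℤ_) (∑-*ˡ c xs f)) (sym (ℤP.*-distribˡ-+ c (f x) _))

∑-- : {X : Set} (xs : List X) (f g : X → ℤ) → ∑ xs (λ x → f x -ℤ g x) ≡ ∑ xs f -ℤ ∑ xs g
∑-- []       f g = refl
∑-- (x ∷ xs) f g = trans (cong (f x -ℤ g x +ℤ_) (∑-- xs f g)) (interchange (f x) (g x) _ _)
  where
  interchange : ∀ a b c d → (a -ℤ b) +ℤ (c -ℤ d) ≡ (a +ℤ c) -ℤ (b +ℤ d)
  interchange = solve-∀

∑-zero : {X : Set} (xs : List X) → ∑ xs (λ _ → 0ℤ) ≡ 0ℤ
∑-zero []       = refl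
∑-zero (_ ∷ xs) = trans (ℤP.+-identityˡ _) (∑-zero xs)

∑-+ : {X : Set} (xs : List X) (f g : X → ℤ) → ∑ xs (λ x → f x +ℤ g x) ≡ ∑ xs f +ℤ ∑ xs g
∑-+ []       f g = refl
∑-+ (x ∷ xs) f g = trans (cong (f x +ℤ g x +ℤ_) (∑-+ xs f g)) (interchange (f x) (g x) _ _)
  where
  interchange : ∀ a b c d → (a +ℤ b) +ℤ (c +ℤ d) ≡ (a +ℤ c) +ℤ (b +ℤ d)
  interchange = solve-∀

∑≢0⇒∃ : {X : Set} (xs : List X) (f : X → ℤ) → ∑ xs f ≢ 0ℤ → ∃[ x ] f x ≢ 0ℤ
∑≢0⇒∃ []       f ∑≢0 = ⊥-elim (∑≢0 refl)
∑≢0⇒∃ (x ∷ xs) f ∑≢0 with f x ℤ.≟ 0ℤ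
... | no  fx≢0 = x , fx≢0
... | yes fx≡0 = ∑≢0⇒∃ xs f λ rest≡0 → ∑≢0 (cong₂ _+ℤ_ fx≡0 rest≡0)

termValue : (Monomial n → ℤ) → ℤ × Monomial n → ℤ
termValue g (a , m) = a *ℤ g m

infix 8 ⟦_⟧_

-- Polynomials are unnormalised term lists, so they are compared only through these functionals.
⟦_⟧_ : Poly n → (Monomial n → ℤ) → ℤ
⟦ p ⟧ g = ∑ p (termValue g)

𝟙 : Bool → ℤ
𝟙 b = if b then 1ℤ else 0ℤ

δ : Monomial n → Monomial n → ℤ
δ m m' = 𝟙 (does (m' ≟ᴹ m))

coeff≡⟦⟧δ : (p : Poly n) (m : Monomial n) → coeff p m ≡ ⟦ p ⟧ δ m
coeff≡⟦⟧δ []            m = refl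
coeff≡⟦⟧δ ((a , m') ∷ p) m with m' ≟ᴹ m
... | yes _ = cong₂ _+ℤ_ (sym (ℤP.*-identityʳ a)) (coeff≡⟦⟧δ p m)
... | no  _ = trans (coeff≡⟦⟧δ p m)
                    (sym (trans (cong (_+ℤ ⟦ p ⟧ δ m) (ℤP.*-zeroʳ a)) (ℤP.+-identityˡ _)))

⟦⟧-cong : (p : Poly n) {g h : Monomial n → ℤ} → g ≗ h → ⟦ p ⟧ g ≡ ⟦ p ⟧ h
⟦⟧-cong p g≗h = ∑-cong p λ t → cong (proj₁ t *ℤ_) (g≗h (proj₂ t))

⟦⟧≢0⇒∃ : (p : Poly n) (g : Monomial n → ℤ) → ⟦ p ⟧ g ≢ 0ℤ → ∃[ m ] g m ≢ 0ℤ
⟦⟧≢0⇒∃ p g ⟦p⟧≢0 with ∑≢0⇒∃ p _ ⟦p⟧≢0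
... | (a , m) , a*gm≢0 = m , λ gm≡0 → a*gm≢0 (trans (cong (a *ℤ_) gm≡0) (ℤP.*-zeroʳ a))

⟦⟧-∑ : {X : Set} (p : Poly n) (xs : List X) (f : X → Monomial n → ℤ) →
       ⟦ p ⟧ (λ m → ∑ xs (λ x → f x m)) ≡ ∑ xs (λ x → ⟦ p ⟧ f x)
⟦⟧-∑ []            xs f = sym (∑-zero xs)
⟦⟧-∑ ((a , m) ∷ p) xs f = begin
  a *ℤ ∑ xs (λ x → f x m) +ℤ ⟦ p ⟧ (λ m' → ∑ xs (λ x → f x m'))
    ≡⟨ cong₂ _+ℤ_ (sym (∑-*ˡ a xs (λ x → f x m))) (⟦⟧-∑ p xs f) ⟩
  ∑ xs (λ x → a *ℤ f x m) +ℤ ∑ xs (λ x → ⟦ p ⟧ f x)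
    ≡⟨ sym (∑-+ xs (λ x → a *ℤ f x m) (λ x → ⟦ p ⟧ f x)) ⟩
  ∑ xs (λ x → ⟦ (a , m) ∷ p ⟧ f x) ∎
  where open ≡-Reasoning

⟦⟧--P : (p q : Poly n) (g : Monomial n → ℤ) → ⟦ p -P q ⟧ g ≡ ⟦ p ⟧ g -ℤ ⟦ q ⟧ g
⟦⟧--P p q g = begin
  ⟦ p -P q ⟧ g
    ≡⟨ ∑-++ p (List.map negate q) (termValue g) ⟩
  ⟦ p ⟧ g +ℤ ∑ (List.map negate q) (termValue g)
    ≡⟨ cong (⟦ p ⟧ g +ℤ_) (∑-map negate q (termValue g)) ⟩
  ⟦ p ⟧ g +ℤ ∑ q (λ t → ℤ.- proj₁ t *ℤ g (proj₂ t))
    ≡⟨ cong (⟦ p ⟧ g +ℤ_) (∑-cong q λ t → sym (ℤP.neg-distribˡ-* (proj₁ t) (g (proj₂ t)))) ⟩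
  ⟦ p ⟧ g +ℤ ∑ q (λ t → ℤ.- termValue g t)
    ≡⟨ cong (⟦ p ⟧ g +ℤ_) (∑-neg q (termValue g)) ⟩
  ⟦ p ⟧ g -ℤ ⟦ q ⟧ g ∎
  where
  open ≡-Reasoning
  negate : ℤ × Monomial _ → ℤ × Monomial _
  negate t = ℤ.- proj₁ t , proj₂ t
  ∑-neg : {X : Set} (xs : List X) (f : X → ℤ) → ∑ xs (λ x → ℤ.- f x) ≡ ℤ.- ∑ xs f
  ∑-neg xs f = trans (∑-cong xs λ x → sym (ℤP.-1*i≡-i (f x))) (trans (∑-*ˡ -1ℤ xs f) (ℤP.-1*i≡-i _))

⟦⟧-*P : (p q : Poly n) (g : Monomial n → ℤ) →
        ⟦ p *P q ⟧ g ≡ ⟦ p ⟧ (λ m₁ → ⟦ q ⟧ (λ m₂ → g (m₁ *ᴹ m₂)))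
⟦⟧-*P p q g = begin
  ⟦ p *P q ⟧ g
    ≡⟨ ∑-concatMap shiftBy p (termValue g) ⟩
  ∑ p (λ t → ∑ (shiftBy t) (termValue g))
    ≡⟨ ∑-cong p (λ t → ∑-map (times t) q (termValue g)) ⟩
  ∑ p (λ t → ∑ q (λ s → (proj₁ t *ℤ proj₁ s) *ℤ g (proj₂ t *ᴹ proj₂ s)))
    ≡⟨ ∑-cong p (λ t → trans (∑-cong q λ s → ℤP.*-assoc (proj₁ t) (proj₁ s) _)
                             (∑-*ˡ (proj₁ t) q (λ s → proj₁ s *ℤ g (proj₂ t *ᴹ proj₂ s)))) ⟩
  ⟦ p ⟧ (λ m₁ → ⟦ q ⟧ (λ m₂ → g (m₁ *ᴹ m₂))) ∎
  where
  open ≡-Reasoning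
  times : ℤ × Monomial _ → ℤ × Monomial _ → ℤ × Monomial _
  times t s = proj₁ t *ℤ proj₁ s , Vec.zipWith _+_ (proj₂ t) (proj₂ s)
  shiftBy : ℤ × Monomial _ → Poly _
  shiftBy t = List.map (times t) q

binomial : Fin n → Fin n → ℕ → Poly n
binomial i j d = varPow i d -P varPow j d

⟦binomial⟧ : (i j : Fin n) (d : ℕ) (g : Monomial n → ℤ) →
             ⟦ binomial i j d ⟧ g ≡ g (x[ i ]^ d) -ℤ g (x[ j ]^ d)
⟦binomial⟧ i j d g =
  trans (⟦⟧--P (varPow i d) (varPow j d) g) (cong₂ _-ℤ_ (⟦monomial⟧ (x[ i ]^ d)) (⟦monomial⟧ (x[ j ]^ d)))
  where
  ⟦monomial⟧ : (m : Monomial _) → 1ℤ *ℤ g m +ℤ 0ℤ ≡ g m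
  ⟦monomial⟧ m = trans (ℤP.+-identityʳ _) (ℤP.*-identityˡ (g m))

infix 4 _≃_⋆_

-- p ≃ H ⋆ q means p = (Σ_{h ∈ H} x^h)·q, compared through the functionals ⟦_⟧.
record _≃_⋆_ (p : Poly n) (H : List (Monomial n)) (q : Poly n) : Set where
  constructor cofactors
  field ⟦⟧-cofactors : ∀ g → ⟦ p ⟧ g ≡ ∑ H (λ h → ⟦ q ⟧ (λ m → g (h *ᴹ m)))
open _≃_⋆_

geometricTerms : Fin n → Fin n → ℕ → List (Monomial n)
geometricTerms i j zero    = []
geometricTerms i j (suc d) = x[ j ]^ d ∷ List.map (x[ i ]^ 1 *ᴹ_) (geometricTerms i j d)

-- x^(d+1) − y^(d+1) = (x − y)·y^d + x·(x^d − y^d)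
binomial-factor : (i j : Fin n) (d : ℕ) → binomial i j d ≃ geometricTerms i j d ⋆ binomial i j 1
binomial-factor i j d = cofactors (telescope d)
  where
  telescope : ∀ d g → ⟦ binomial i j d ⟧ g
                      ≡ ∑ (geometricTerms i j d) (λ h → ⟦ binomial i j 1 ⟧ (λ m → g (h *ᴹ m)))
  telescope zero g = begin
    ⟦ binomial i j 0 ⟧ g                ≡⟨ ⟦binomial⟧ i j 0 g ⟩
    g (x[ i ]^ 0) -ℤ g (x[ j ]^ 0)      ≡⟨ cong₂ (λ u w → g u -ℤ g w) (x^0≡1ᴹ i) (x^0≡1ᴹ j) ⟩
    g 1ᴹ -ℤ g 1ᴹ                        ≡⟨ ℤP.+-inverseʳ (g 1ᴹ) ⟩
    0ℤ                                  ∎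
    where open ≡-Reasoning
  telescope (suc d) g = begin
    ⟦ binomial i j (suc d) ⟧ g
      ≡⟨ ⟦binomial⟧ i j (suc d) g ⟩
    g xᵈ⁺¹ -ℤ g yᵈ⁺¹
      ≡⟨ split (g xᵈ⁺¹) (g yᵈ⁺¹) (g (x *ᴹ yᵈ)) ⟩
    (g (x *ᴹ yᵈ) -ℤ g yᵈ⁺¹) +ℤ (g xᵈ⁺¹ -ℤ g (x *ᴹ yᵈ))
      ≡⟨ cong₂ _+ℤ_ (sym lowest-term) (sym higher-terms) ⟩
    ⟦ binomial i j 1 ⟧ (λ m → g (yᵈ *ᴹ m)) +ℤ ∑ (List.map (x *ᴹ_) (geometricTerms i j d)) F ∎
    where
    open ≡-Reasoning
    x = x[ i ]^ 1
    xᵈ⁺¹ = x[ i ]^ suc d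
    yᵈ = x[ j ]^ d
    yᵈ⁺¹ = x[ j ]^ suc d
    F : Monomial _ → ℤ
    F h = ⟦ binomial i j 1 ⟧ (λ m → g (h *ᴹ m))
    split : ∀ a b c → a -ℤ b ≡ (c -ℤ b) +ℤ (a -ℤ c)
    split = solve-∀
    lowest-term : ⟦ binomial i j 1 ⟧ (λ m → g (yᵈ *ᴹ m)) ≡ g (x *ᴹ yᵈ) -ℤ g yᵈ⁺¹
    lowest-term = trans (⟦binomial⟧ i j 1 (λ m → g (yᵈ *ᴹ m)))
      (cong₂ (λ u w → g u -ℤ g w) (*ᴹ-comm yᵈ x) (trans (x^-*ᴹ j d 1) (cong (x[ j ]^_) (ℕP.+-comm d 1))))
    higher-terms : ∑ (List.map (x *ᴹ_) (geometricTerms i j d)) F ≡ g xᵈ⁺¹ -ℤ g (x *ᴹ yᵈ)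
    higher-terms = begin
      ∑ (List.map (x *ᴹ_) (geometricTerms i j d)) F
        ≡⟨ ∑-map (x *ᴹ_) (geometricTerms i j d) F ⟩
      ∑ (geometricTerms i j d) (F ∘ (x *ᴹ_))
        ≡⟨ ∑-cong (geometricTerms i j d) (λ h → ⟦⟧-cong (binomial i j 1) λ m → cong g (*ᴹ-assoc x h m)) ⟩
      ∑ (geometricTerms i j d) (λ h → ⟦ binomial i j 1 ⟧ (λ m → g (x *ᴹ (h *ᴹ m))))
        ≡⟨ telescope d (λ m → g (x *ᴹ m)) ⟨
      ⟦ binomial i j d ⟧ (λ m → g (x *ᴹ m))
        ≡⟨ ⟦binomial⟧ i j d (λ m → g (x *ᴹ m)) ⟩
      g (x *ᴹ x[ i ]^ d) -ℤ g (x *ᴹ yᵈ)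
        ≡⟨ cong (λ u → g u -ℤ g (x *ᴹ yᵈ)) (x^-*ᴹ i 1 d) ⟩
      g xᵈ⁺¹ -ℤ g (x *ᴹ yᵈ) ∎

infixl 7 _⊗_

_⊗_ : List (Monomial n) → List (Monomial n) → List (Monomial n)
H ⊗ H' = List.concatMap (λ u → List.map (u *ᴹ_) H') H

*P-≃ : {p q p' q' : Poly n} {H H' : List (Monomial n)} →
       p ≃ H ⋆ q → p' ≃ H' ⋆ q' → p *P p' ≃ H ⊗ H' ⋆ q *P q'
*P-≃ {p = p} {q} {p'} {q'} {H} {H'} (cofactors p≃) (cofactors p'≃) = cofactors λ g → begin
  ⟦ p *P p' ⟧ g
    ≡⟨ ⟦⟧-*P p p' g ⟩
  ⟦ p ⟧ (λ m₁ → ⟦ p' ⟧ (λ m₂ → g (m₁ *ᴹ m₂)))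
    ≡⟨ p≃ _ ⟩
  ∑ H (λ u → ⟦ q ⟧ (λ m₁ → ⟦ p' ⟧ (λ m₂ → g ((u *ᴹ m₁) *ᴹ m₂))))
    ≡⟨ ∑-cong H (λ u → ⟦⟧-cong q λ m₁ → p'≃ _) ⟩
  ∑ H (λ u → ⟦ q ⟧ (λ m₁ → ∑ H' (λ h → ⟦ q' ⟧ (λ m₂ → g ((u *ᴹ m₁) *ᴹ (h *ᴹ m₂))))))
    ≡⟨ ∑-cong H (λ u → ⟦⟧-∑ q H' _) ⟩
  ∑ H (λ u → ∑ H' (λ h → ⟦ q ⟧ (λ m₁ → ⟦ q' ⟧ (λ m₂ → g ((u *ᴹ m₁) *ᴹ (h *ᴹ m₂))))))
    ≡⟨ ∑-cong H (λ u → ∑-cong H' λ h → ⟦⟧-cong q λ m₁ → ⟦⟧-cong q' λ m₂ →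
                   cong g (*ᴹ-interchange u m₁ h m₂)) ⟩
  ∑ H (λ u → ∑ H' (λ h → ⟦ q ⟧ (λ m₁ → ⟦ q' ⟧ (λ m₂ → g ((u *ᴹ h) *ᴹ (m₁ *ᴹ m₂))))))
    ≡⟨ ∑-cong H (λ u → ∑-cong H' λ h → sym (⟦⟧-*P q q' (λ m → g ((u *ᴹ h) *ᴹ m)))) ⟩
  ∑ H (λ u → ∑ H' (λ h → ⟦ q *P q' ⟧ (λ m → g ((u *ᴹ h) *ᴹ m))))
    ≡⟨ ∑-cong H (λ u → sym (∑-map (u *ᴹ_) H' (λ w → ⟦ q *P q' ⟧ (λ m → g (w *ᴹ m))))) ⟩
  ∑ H (λ u → ∑ (List.map (u *ᴹ_) H') (λ w → ⟦ q *P q' ⟧ (λ m → g (w *ᴹ m))))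
    ≡⟨ sym (∑-concatMap (λ u → List.map (u *ᴹ_) H') H (λ w → ⟦ q *P q' ⟧ (λ m → g (w *ᴹ m)))) ⟩
  ∑ (H ⊗ H') (λ w → ⟦ q *P q' ⟧ (λ m → g (w *ᴹ m))) ∎
  where open ≡-Reasoning

prodP-≃ : {X : Set} (p q : X → Poly n) (H : X → List (Monomial n)) →
          (∀ x → p x ≃ H x ⋆ q x) →
          ∀ xs → prodP (List.map p xs) ≃ List.foldr (_⊗_ ∘ H) (1ᴹ ∷ []) xs ⋆ prodP (List.map q xs)
prodP-≃ p q H p≃ []       =
  cofactors λ g → sym (trans (ℤP.+-identityʳ _) (⟦⟧-cong oneP λ m → cong g (*ᴹ-identityˡ m)))
prodP-≃ p q H p≃ (x ∷ xs) = *P-≃ (p≃ x) (prodP-≃ p q H p≃ xs)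

δ≢0⇒≡ : (m m' : Monomial n) → δ m m' ≢ 0ℤ → m' ≡ m
δ≢0⇒≡ m m' δ≢0 with m' ≟ᴹ m
... | yes m'≡m = m'≡m
... | no  _    = ⊥-elim (δ≢0 refl)

δ-*ᴹ : {h m' m : Monomial n} → h *ᴹ m' ≡ m → ∀ x → δ m (h *ᴹ x) ≡ δ m' x
δ-*ᴹ {h = h} {m'} {m} hm'≡m x with h *ᴹ x ≟ᴹ m | x ≟ᴹ m'
... | yes _   | yes _    = refl
... | no  _   | no  _    = refl
... | yes hx≡m | no x≢m' = ⊥-elim (x≢m' (*ᴹ-cancelˡ h x m' (trans hx≡m (sym hm'≡m))))
... | no hx≢m | yes x≡m' = ⊥-elim (hx≢m (trans (cong (h *ᴹ_) x≡m') hm'≡m))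

≃-support : {p q : Poly n} {H : List (Monomial n)} → p ≃ H ⋆ q →
            ∀ m → coeff p m ≢ 0ℤ → ∃[ m' ] coeff q m' ≢ 0ℤ × ∃[ h ] h *ᴹ m' ≡ m
≃-support {p = p} {q} {H} p≃ m cₘ≢0
  with ∑≢0⇒∃ H _ (λ ∑≡0 → cₘ≢0 (trans (coeff≡⟦⟧δ p m) (trans (⟦⟧-cofactors p≃ (δ m)) ∑≡0)))
... | h , ⟦q⟧≢0 with ⟦⟧≢0⇒∃ q _ ⟦q⟧≢0
... | m' , δ≢0 = m' , coeff≢0 , h , hm'≡m
  where
  hm'≡m = δ≢0⇒≡ m (h *ᴹ m') δ≢0
  coeff≢0 : coeff q m' ≢ 0ℤ
  coeff≢0 c≡0 = ⟦q⟧≢0 (trans (⟦⟧-cong q (δ-*ᴹ hm'≡m)) (trans (sym (coeff≡⟦⟧δ q m')) c≡0))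

Homogeneous : ℕ → Poly n → Set
Homogeneous d p = All (λ t → degM (proj₂ t) ≡ d) p

degM-*ᴹ : (u w : Monomial n) → degM (u *ᴹ w) ≡ degM u + degM w
degM-*ᴹ []      []      = refl
degM-*ᴹ (a ∷ u) (b ∷ w) = trans (cong (a + b +_) (degM-*ᴹ u w)) (interchange a b (degM u) (degM w))
  where
  interchange : ∀ a b c d → (a + b) + (c + d) ≡ (a + c) + (b + d)
  interchange = ℕSolver.solve-∀

degM-1ᴹ : degM (1ᴹ {n}) ≡ 0
degM-1ᴹ {zero}  = refl
degM-1ᴹ {suc n} = degM-1ᴹ {n}

degM-x^ : (i : Fin n) (d : ℕ) → degM (x[ i ]^ d) ≡ d
degM-x^ {suc n} Fin.zero    d = trans (cong (d +_) (degM-zeros n)) (ℕP.+-identityʳ d)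
  where
  degM-zeros : ∀ k → degM (Vec.tabulate {n = k} (λ _ → 0)) ≡ 0
  degM-zeros zero    = refl
  degM-zeros (suc k) = degM-zeros k
degM-x^ {suc n} (Fin.suc i) d = degM-x^ i d

binomial-homogeneous : (i j : Fin n) (d : ℕ) → Homogeneous d (binomial i j d)
binomial-homogeneous i j d = degM-x^ i d ∷ degM-x^ j d ∷ []

*P-homogeneous : {a b : ℕ} {p q : Poly n} → Homogeneous a p → Homogeneous b q → Homogeneous (a + b) (p *P q)
*P-homogeneous {p = []}          []            hq = []
*P-homogeneous {p = (c , m) ∷ p} (deg-m ∷ hp) hq =
  AllP.++⁺ (AllP.map⁺ (All.map (λ {s} deg-s → trans (degM-*ᴹ m (proj₂ s)) (cong₂ _+_ deg-m deg-s)) hq))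
           (*P-homogeneous hp hq)

prodP-homogeneous : {X : Set} (p : X → Poly n) (deg : X → ℕ) → (∀ x → Homogeneous (deg x) (p x)) →
                    ∀ xs → Homogeneous (sum (List.map deg xs)) (prodP (List.map p xs))
prodP-homogeneous {n} p deg hp []       = degM-1ᴹ {n} ∷ []
prodP-homogeneous {n} p deg hp (x ∷ xs) = *P-homogeneous (hp x) (prodP-homogeneous p deg hp xs)

coeff≢0⇒∈support : (p : Poly n) (m : Monomial n) → coeff p m ≢ 0ℤ → m ∈ support p
coeff≢0⇒∈support p m c≢0 = ∈P.∈-filter⁺ (λ m → ¬? (coeff p m ℤ.≟ 0ℤ)) (occurs p c≢0) c≢0
  where
  occurs : (p : Poly _) → coeff p m ≢ 0ℤ → m ∈ List.map proj₂ p
  occurs []             c≢0 = ⊥-elim (c≢0 refl)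
  occurs ((a , m') ∷ p) c≢0 with m' ≟ᴹ m
  ... | yes m'≡m = here (sym m'≡m)
  ... | no  _    = there (occurs p c≢0)

support-homogeneous : {d : ℕ} (p : Poly n) → Homogeneous d p → All (λ m → degM m ≡ d) (support p)
support-homogeneous p hp = AllP.filter⁺ _ (AllP.map⁺ hp)

degP-homogeneous : {d : ℕ} (p : Poly n) → Homogeneous d p →
                   ∀ m → coeff p m ≢ 0ℤ → degM m ≡ degP p
degP-homogeneous {d = d} p hp m c≢0 =
  trans (All.lookup (support-homogeneous p hp) m∈supp)
        (sym (⊔-fold-constant (List.map degM (support p)) (AllP.map⁺ (support-homogeneous p hp))
                              (∈P.∈-map⁺ degM m∈supp)))
  where
  m∈supp = coeff≢0⇒∈support p m c≢0
  ⊔-fold-constant : ∀ {x} xs → All (_≡ d) xs → x ∈ xs → List.foldr _⊔_ 0 xs ≡ d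
  ⊔-fold-constant (x ∷ [])     (x≡d ∷ [])        _ = trans (ℕP.⊔-identityʳ x) x≡d
  ⊔-fold-constant (x ∷ y ∷ xs) (x≡d ∷ y∷xs≡d) _ =
    trans (cong₂ _⊔_ x≡d (⊔-fold-constant (y ∷ xs) y∷xs≡d (here refl))) (ℕP.⊔-idem d)

minList-≤ : ∀ {x} xs → x ∈ xs → minList xs ≤ x
minList-≤ (x ∷ [])     (here refl) = ℕP.≤-refl
minList-≤ (x ∷ y ∷ xs) (here refl) = ℕP.m⊓n≤m x _
minList-≤ (x ∷ y ∷ xs) (there x∈) = ℕP.≤-trans (ℕP.m⊓n≤n x _) (minList-≤ (y ∷ xs) x∈)

minList-∷-∈ : ∀ x xs → minList (x ∷ xs) ∈ x ∷ xs
minList-∷-∈ x []       = here refl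
minList-∷-∈ x (y ∷ xs) with ℕP.⊓-sel x (minList (y ∷ xs))
... | inj₁ x⊓r≡x = here x⊓r≡x
... | inj₂ x⊓r≡r = there (subst (_∈ y ∷ xs) (sym x⊓r≡r) (minList-∷-∈ y xs))

minList-map-∈ : {A : Set} (f : A → ℕ) {x : A} (xs : List A) → x ∈ xs →
                ∃[ y ] y ∈ xs × minList (List.map f xs) ≡ f y
minList-map-∈ f (x ∷ xs) _ = ∈P.∈-map⁻ f (minList-∷-∈ (f x) (List.map f xs))

topMonomials : Poly n → List (Monomial n)
topMonomials p = List.filter (λ m → degM m ℕP.≟ degP p) (support p)

coeff≢0⇒∈topMonomials : (p : Poly n) (m : Monomial n) → coeff p m ≢ 0ℤ → degM m ≡ degP p →
                         m ∈ topMonomials p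
coeff≢0⇒∈topMonomials p m c≢0 = ∈P.∈-filter⁺ (λ m → degM m ℕP.≟ degP p) (coeff≢0⇒∈support p m c≢0)

α-≤ : (p : Poly n) (m : Monomial n) → coeff p m ≢ 0ℤ → degM m ≡ degP p → α p ≤ maxExp m
α-≤ p m c≢0 top =
  minList-≤ (List.map maxExp (topMonomials p)) (∈P.∈-map⁺ maxExp (coeff≢0⇒∈topMonomials p m c≢0 top))

topMonomial⇒coeff≢0 : (p : Poly n) {m : Monomial n} → m ∈ topMonomials p → coeff p m ≢ 0ℤ
topMonomial⇒coeff≢0 p m∈top =
  proj₂ (∈P.∈-filter⁻ nonzero? {xs = List.map proj₂ p}
                      (proj₁ (∈P.∈-filter⁻ top? {xs = support p} m∈top)))
  where
  nonzero? : ∀ m → Dec (coeff p m ≢ 0ℤ)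
  nonzero? m = ¬? (coeff p m ℤ.≟ 0ℤ)
  top? : ∀ m → Dec (degM m ≡ degP p)
  top? m = degM m ℕP.≟ degP p

α-attained : (p : Poly n) (m : Monomial n) → coeff p m ≢ 0ℤ → degM m ≡ degP p →
             ∃[ m* ] coeff p m* ≢ 0ℤ × α p ≡ maxExp m*
α-attained p m c≢0 top with minList-map-∈ maxExp (topMonomials p) (coeff≢0⇒∈topMonomials p m c≢0 top)
... | m* , m*∈top , α≡ = m* , topMonomial⇒coeff≢0 p m*∈top , α≡

maxExp-*ᴹ : (h m : Monomial n) → maxExp m ≤ maxExp (h *ᴹ m)
maxExp-*ᴹ []      []      = ℕP.≤-refl
maxExp-*ᴹ (a ∷ h) (b ∷ m) = ℕP.⊔-mono-≤ (ℕP.m≤n+m b a) (maxExp-*ᴹ h m)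

map-allFin-suc : ∀ {k} {A : Set} (f : Fin (suc k) → A) →
                 List.map f (List.allFin (suc k)) ≡ f Fin.zero ∷ List.map (f ∘ Fin.suc) (List.allFin k)
map-allFin-suc f =
  trans (ListP.map-tabulate (λ e → e) f) (cong (f Fin.zero ∷_) (sym (ListP.map-tabulate (λ e → e) (f ∘ Fin.suc))))

record AugmentedOrientation (n k : ℕ) : Set where
  field
    end₁ end₂ : Fin k → Fin n
    orient    : Fin k → Bool
    strength  : Fin k → ℕ

  tailE headE : Fin k → Fin n
  tailE e = if orient e then end₁ e else end₂ e
  headE e = if orient e then end₂ e else end₁ e

open AugmentedOrientation

dropEdge : ∀ {k} → AugmentedOrientation n (suc k) → AugmentedOrientation n k
dropEdge E = record
  { end₁ = end₁ E ∘ Fin.suc ; end₂ = end₂ E ∘ Fin.suc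
  ; orient = orient E ∘ Fin.suc ; strength = strength E ∘ Fin.suc }

Wᴱ : ∀ {k} → AugmentedOrientation n k → Poly n
Wᴱ {k = k} E = prodP (List.map (λ e → binomial (end₁ E e) (end₂ E e) (strength E e)) (List.allFin k))

-- e ∈ S selects the term x_tail^D of the e-th factor, e ∉ S the term x_head^D.
choiceMonomial : ∀ {k} → AugmentedOrientation n k → Subset k → Monomial n
choiceMonomial E []      = 1ᴹ
choiceMonomial E (s ∷ S) =
  x[ if s then tailE E Fin.zero else headE E Fin.zero ]^ strength E Fin.zero *ᴹ choiceMonomial (dropEdge E) S

-- termSign (O e) s is the sign of x_tail^D (s = true) or of x_head^D (s = false) in x_A^D − x_B^D.
termSign : Bool → Bool → ℤ
termSign true  true  = 1ℤ
termSign true  false = -1ℤ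
termSign false true  = -1ℤ
termSign false false = 1ℤ

sign : ∀ {k} → AugmentedOrientation n k → Subset k → ℤ
sign E []      = 1ℤ
sign E (s ∷ S) = termSign (orient E Fin.zero) s *ℤ sign (dropEdge E) S

binomial-oriented : (o : Bool) (a b : Fin n) (d : ℕ) (g : Monomial n → ℤ) →
                    ⟦ binomial a b d ⟧ g ≡ termSign o true *ℤ g (x[ if o then a else b ]^ d)
                                           +ℤ termSign o false *ℤ g (x[ if o then b else a ]^ d)
binomial-oriented true  a b d g = trans (⟦binomial⟧ a b d g) (solved (g (x[ a ]^ d)) (g (x[ b ]^ d)))
  where
  solved : ∀ x y → x -ℤ y ≡ 1ℤ *ℤ x +ℤ -1ℤ *ℤ y
  solved = solve-∀
binomial-oriented false a b d g = trans (⟦binomial⟧ a b d g) (solved (g (x[ a ]^ d)) (g (x[ b ]^ d)))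
  where
  solved : ∀ x y → x -ℤ y ≡ -1ℤ *ℤ y +ℤ 1ℤ *ℤ x
  solved = solve-∀

⟦Wᴱ⟧-expansion : ∀ {k} (E : AugmentedOrientation n k) (g : Monomial n → ℤ) →
                 ⟦ Wᴱ E ⟧ g ≡ ∑ (allSubsets k) (λ S → sign E S *ℤ g (choiceMonomial E S))
⟦Wᴱ⟧-expansion {k = zero}  E g = refl
⟦Wᴱ⟧-expansion {k = suc k} E g = begin
  ⟦ Wᴱ E ⟧ g
    ≡⟨ cong (λ fs → ⟦ prodP fs ⟧ g) (map-allFin-suc (λ e → binomial (end₁ E e) (end₂ E e) (strength E e))) ⟩
  ⟦ binomial (end₁ E Fin.zero) (end₂ E Fin.zero) d *P Wᴱ E' ⟧ g
    ≡⟨ ⟦⟧-*P (binomial (end₁ E Fin.zero) (end₂ E Fin.zero) d) (Wᴱ E') g ⟩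
  ⟦ binomial (end₁ E Fin.zero) (end₂ E Fin.zero) d ⟧ φ
    ≡⟨ binomial-oriented (orient E Fin.zero) (end₁ E Fin.zero) (end₂ E Fin.zero) d φ ⟩
  termSign (orient E Fin.zero) true *ℤ φ (x[ tailE E Fin.zero ]^ d)
    +ℤ termSign (orient E Fin.zero) false *ℤ φ (x[ headE E Fin.zero ]^ d)
    ≡⟨ cong₂ _+ℤ_ (branch true) (branch false) ⟩
  ∑ (List.map (inside ∷_) (allSubsets k)) T +ℤ ∑ (List.map (outside ∷_) (allSubsets k)) T
    ≡⟨ sym (∑-++ (List.map (inside ∷_) (allSubsets k)) _ T) ⟩
  ∑ (allSubsets (suc k)) T ∎
  where
  open ≡-Reasoning
  d = strength E Fin.zero
  E' = dropEdge E
  φ : Monomial _ → ℤ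
  φ m₁ = ⟦ Wᴱ E' ⟧ (λ m₂ → g (m₁ *ᴹ m₂))
  T : Subset (suc k) → ℤ
  T S = sign E S *ℤ g (choiceMonomial E S)
  branch : ∀ s → termSign (orient E Fin.zero) s *ℤ φ (x[ if s then tailE E Fin.zero else headE E Fin.zero ]^ d)
                 ≡ ∑ (List.map (s ∷_) (allSubsets k)) T
  branch s = begin
    c *ℤ φ xᶜ
      ≡⟨ cong (c *ℤ_) (⟦Wᴱ⟧-expansion E' (λ m₂ → g (xᶜ *ᴹ m₂))) ⟩
    c *ℤ ∑ (allSubsets k) (λ S → sign E' S *ℤ g (xᶜ *ᴹ choiceMonomial E' S))
      ≡⟨ sym (∑-*ˡ c (allSubsets k) _) ⟩
    ∑ (allSubsets k) (λ S → c *ℤ (sign E' S *ℤ g (xᶜ *ᴹ choiceMonomial E' S)))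
      ≡⟨ ∑-cong (allSubsets k) (λ S → sym (ℤP.*-assoc c (sign E' S) _)) ⟩
    ∑ (allSubsets k) (T ∘ (s ∷_))
      ≡⟨ sym (∑-map (s ∷_) (allSubsets k) T) ⟩
    ∑ (List.map (s ∷_) (allSubsets k)) T ∎
    where
    c = termSign (orient E Fin.zero) s
    xᶜ = x[ if s then tailE E Fin.zero else headE E Fin.zero ]^ d

inContribution outContribution : ∀ {k} → AugmentedOrientation n k → Subset k → Fin n → Fin k → ℕ
inContribution  E S v e = if Vec.lookup S e ∧ does (headE E e Fin.≟ v) then strength E e else 0
outContribution E S v e = if Vec.lookup S e ∧ does (tailE E e Fin.≟ v) then strength E e else 0

inDegree outDegree : ∀ {k} → AugmentedOrientation n k → Subset k → Fin n → ℕ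
inDegree  {k = k} E S v = sum (List.map (inContribution E S v) (List.allFin k))
outDegree {k = k} E S v = sum (List.map (outContribution E S v) (List.allFin k))

inDegreeMonomial : ∀ {k} → AugmentedOrientation n k → Monomial n
inDegreeMonomial E = Vec.tabulate (inDegree E ⊤)

-- Each edge of S moves its strength from the head to the tail of the in-degree vector.
choiceMonomial-degrees : ∀ {k} (E : AugmentedOrientation n k) (S : Subset k) (v : Fin n) →
                         Vec.lookup (choiceMonomial E S) v + inDegree E S v ≡ inDegree E ⊤ v + outDegree E S v
choiceMonomial-degrees E []      v = cong (_+ 0) (VecP.lookup-replicate v 0)
choiceMonomial-degrees E (s ∷ S) v = begin
  Vec.lookup (x[ chosen ]^ d *ᴹ choiceMonomial E' S) v + inDegree E (s ∷ S) v
    ≡⟨ cong₂ _+_ (lookup-*ᴹ (x[ chosen ]^ d) (choiceMonomial E' S) v)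
                  (cong sum (map-allFin-suc (inContribution E (s ∷ S) v))) ⟩
  (Vec.lookup (x[ chosen ]^ d) v + Vec.lookup (choiceMonomial E' S) v) + (inˢ + inDegree E' S v)
    ≡⟨ interchange (Vec.lookup (x[ chosen ]^ d) v) _ inˢ _ ⟩
  (Vec.lookup (x[ chosen ]^ d) v + inˢ) + (Vec.lookup (choiceMonomial E' S) v + inDegree E' S v)
    ≡⟨ cong₂ _+_ (first-edge s) (choiceMonomial-degrees E' S v) ⟩
  (inᵀ + outˢ) + (inDegree E' ⊤ v + outDegree E' S v)
    ≡⟨ interchange inᵀ outˢ _ _ ⟩
  (inᵀ + inDegree E' ⊤ v) + (outˢ + outDegree E' S v)
    ≡⟨ cong₂ _+_ (cong sum (map-allFin-suc (inContribution E ⊤ v)))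
                 (cong sum (map-allFin-suc (outContribution E (s ∷ S) v))) ⟨
  inDegree E ⊤ v + outDegree E (s ∷ S) v ∎
  where
  open ≡-Reasoning
  E' = dropEdge E
  d = strength E Fin.zero
  chosen = if s then tailE E Fin.zero else headE E Fin.zero
  inᵀ = if does (headE E Fin.zero Fin.≟ v) then d else 0
  inˢ = if s ∧ does (headE E Fin.zero Fin.≟ v) then d else 0
  outˢ = if s ∧ does (tailE E Fin.zero Fin.≟ v) then d else 0
  interchange : ∀ w x y z → (w + x) + (y + z) ≡ (w + y) + (x + z)
  interchange = ℕSolver.solve-∀
  first-edge : ∀ s → Vec.lookup (x[ if s then tailE E Fin.zero else headE E Fin.zero ]^ d) v
                     + (if s ∧ does (headE E Fin.zero Fin.≟ v) then d else 0)
                     ≡ inᵀ + (if s ∧ does (tailE E Fin.zero Fin.≟ v) then d else 0)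
  first-edge true  = trans (cong (_+ inᵀ) (lookup-x^ (tailE E Fin.zero) d v)) (ℕP.+-comm _ inᵀ)
  first-edge false = cong (_+ 0) (lookup-x^ (headE E Fin.zero) d v)

Balanced : ∀ {k} → AugmentedOrientation n k → Subset k → Set
Balanced E S = ∀ v → inDegree E S v ≡ outDegree E S v

choiceMonomial≡inDegreeMonomial⇔Balanced : ∀ {k} (E : AugmentedOrientation n k) (S : Subset k) →
                                           choiceMonomial E S ≡ inDegreeMonomial E ⇔ Balanced E S
choiceMonomial≡inDegreeMonomial⇔Balanced E S = mk⇔
  (λ eq v → ℕP.+-cancelˡ-≡ (inDegree E ⊤ v) _ _
              (trans (cong (_+ inDegree E S v) (sym (lookup-inDegreeMonomial eq v))) (choiceMonomial-degrees E S v)))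
  (λ balanced → ≗-lookup⇒≡ λ v → trans
     (ℕP.+-cancelʳ-≡ (inDegree E S v) _ _
        (trans (choiceMonomial-degrees E S v) (cong (inDegree E ⊤ v +_) (sym (balanced v)))))
     (sym (VecP.lookup∘tabulate (inDegree E ⊤) v)))
  where
  lookup-inDegreeMonomial : choiceMonomial E S ≡ inDegreeMonomial E →
                            ∀ v → Vec.lookup (choiceMonomial E S) v ≡ inDegree E ⊤ v
  lookup-inDegreeMonomial eq v = trans (cong (λ u → Vec.lookup u v) eq) (VecP.lookup∘tabulate (inDegree E ⊤) v)

termSign-flip : ∀ o → termSign o true ≡ -1ℤ *ℤ termSign o false
termSign-flip true  = refl
termSign-flip false = refl

sign-parity : ∀ {k} (E : AugmentedOrientation n k) (S : Subset k) → sign E S ≡ sign E ⊥ *ℤ -1ℤ ^ ∣ S ∣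
sign-parity E []      = refl
sign-parity E (true ∷ S) = begin
  termSign o true *ℤ sign (dropEdge E) S
    ≡⟨ cong₂ _*ℤ_ (termSign-flip o) (sign-parity (dropEdge E) S) ⟩
  (-1ℤ *ℤ termSign o false) *ℤ (sign (dropEdge E) ⊥ *ℤ -1ℤ ^ ∣ S ∣)
    ≡⟨ solved (termSign o false) (sign (dropEdge E) ⊥) (-1ℤ ^ ∣ S ∣) ⟩
  (termSign o false *ℤ sign (dropEdge E) ⊥) *ℤ (-1ℤ *ℤ -1ℤ ^ ∣ S ∣) ∎
  where
  open ≡-Reasoning
  o = orient E Fin.zero
  solved : ∀ t a b → (-1ℤ *ℤ t) *ℤ (a *ℤ b) ≡ (t *ℤ a) *ℤ (-1ℤ *ℤ b)
  solved = solve-∀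
sign-parity E (false ∷ S) =
  trans (cong (termSign (orient E Fin.zero) false *ℤ_) (sign-parity (dropEdge E) S))
        (sym (ℤP.*-assoc (termSign (orient E Fin.zero) false) _ _))

sign²≡1 : ∀ {k} (E : AugmentedOrientation n k) (S : Subset k) → sign E S *ℤ sign E S ≡ 1ℤ
sign²≡1 E []      = refl
sign²≡1 E (s ∷ S) = begin
  (t *ℤ a) *ℤ (t *ℤ a)  ≡⟨ interchange t a ⟩
  (t *ℤ t) *ℤ (a *ℤ a)  ≡⟨ cong₂ _*ℤ_ (termSign²≡1 (orient E Fin.zero) s) (sign²≡1 (dropEdge E) S) ⟩
  1ℤ                    ∎
  where
  open ≡-Reasoning
  t = termSign (orient E Fin.zero) s
  a = sign (dropEdge E) S
  interchange : ∀ t a → (t *ℤ a) *ℤ (t *ℤ a) ≡ (t *ℤ t) *ℤ (a *ℤ a)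
  interchange = solve-∀
  termSign²≡1 : ∀ o s → termSign o s *ℤ termSign o s ≡ 1ℤ
  termSign²≡1 true  true  = refl
  termSign²≡1 true  false = refl
  termSign²≡1 false true  = refl
  termSign²≡1 false false = refl

𝟙-∧ : ∀ a b → 𝟙 (a ∧ b) ≡ 𝟙 a *ℤ 𝟙 b
𝟙-∧ true  b = sym (ℤP.*-identityˡ (𝟙 b))
𝟙-∧ false b = sym (ℤP.*-zeroˡ (𝟙 b))

-- k % 2 computes, so suc (suc k) % 2 reduces to k % 2.
-1^-parity : ∀ k → -1ℤ ^ k ≡ 𝟙 (does (k % 2 ℕP.≟ 0)) -ℤ 𝟙 (does (k % 2 ℕP.≟ 1))
-1^-parity zero          = refl
-1^-parity (suc zero)    = refl
-1^-parity (suc (suc k)) =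
  trans (sym (ℤP.*-assoc -1ℤ -1ℤ (-1ℤ ^ k))) (trans (ℤP.*-identityˡ (-1ℤ ^ k)) (-1^-parity k))

∑-𝟙 : {X : Set} {P : X → Set} (P? : ∀ x → Dec (P x)) (xs : List X) →
      ∑ xs (λ x → 𝟙 (does (P? x))) ≡ ℤ.+ List.length (List.filter P? xs)
∑-𝟙 P? []       = refl
∑-𝟙 P? (x ∷ xs) with does (P? x)
... | true  = cong (1ℤ +ℤ_) (∑-𝟙 P? xs)
... | false = trans (ℤP.+-identityˡ _) (∑-𝟙 P? xs)

δ-choiceMonomial : ∀ {k} (E : AugmentedOrientation n k) (S : Subset k) (balanced? : Dec (Balanced E S)) →
                   δ (inDegreeMonomial E) (choiceMonomial E S) ≡ 𝟙 (does balanced?)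
δ-choiceMonomial E S balanced? =
  cong 𝟙 (does-⇔ (choiceMonomial≡inDegreeMonomial⇔Balanced E S)
                 (choiceMonomial E S ≟ᴹ inDegreeMonomial E) balanced?)

augmentedOrientation : (G : SimpleGraph n) → Orientation G → Strength G → AugmentedOrientation n (m G)
augmentedOrientation G O D = record { end₁ = endA G ; end₂ = endB G ; orient = O ; strength = D }

-- W G D ≡ Wᴱ E and IsEulerian G D O ≡ Balanced E hold by definition.
module _ (G : SimpleGraph n) (O : Orientation G) (D : Strength G) where

  private
    E = augmentedOrientation G O D
    mO = inDegreeMonomial E
    Ss = allSubsets (m G)
    isEvenES? : ∀ S → Dec (IsEulerian G D O S × ∣ S ∣ % 2 ≡ 0)
    isEvenES? S = isEulerian? G D O S ×-dec (∣ S ∣ % 2 ℕP.≟ 0)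
    isOddES? : ∀ S → Dec (IsEulerian G D O S × ∣ S ∣ % 2 ≡ 1)
    isOddES? S = isEulerian? G D O S ×-dec (∣ S ∣ % 2 ℕP.≟ 1)

  signed-δ : ∀ S → sign E S *ℤ δ mO (choiceMonomial E S)
                   ≡ sign E ⊥ *ℤ (𝟙 (does (isEvenES? S)) -ℤ 𝟙 (does (isOddES? S)))
  signed-δ S = begin
    sign E S *ℤ δ mO (choiceMonomial E S)
      ≡⟨ cong₂ _*ℤ_ (sign-parity E S) (δ-choiceMonomial E S (isEulerian? G D O S)) ⟩
    (sign E ⊥ *ℤ -1ℤ ^ ∣ S ∣) *ℤ 𝟙 eulerian
      ≡⟨ ℤP.*-assoc (sign E ⊥) _ _ ⟩
    sign E ⊥ *ℤ (-1ℤ ^ ∣ S ∣ *ℤ 𝟙 eulerian)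
      ≡⟨ cong (λ x → sign E ⊥ *ℤ (x *ℤ 𝟙 eulerian)) (-1^-parity ∣ S ∣) ⟩
    sign E ⊥ *ℤ ((𝟙 even -ℤ 𝟙 odd) *ℤ 𝟙 eulerian)
      ≡⟨ cong (sign E ⊥ *ℤ_) (distrib (𝟙 even) (𝟙 odd) (𝟙 eulerian)) ⟩
    sign E ⊥ *ℤ (𝟙 eulerian *ℤ 𝟙 even -ℤ 𝟙 eulerian *ℤ 𝟙 odd)
      ≡⟨ cong (sign E ⊥ *ℤ_) (cong₂ _-ℤ_ (𝟙-∧ eulerian even) (𝟙-∧ eulerian odd)) ⟨
    sign E ⊥ *ℤ (𝟙 (eulerian ∧ even) -ℤ 𝟙 (eulerian ∧ odd)) ∎
    where
    open ≡-Reasoning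
    eulerian = does (isEulerian? G D O S)
    even = does (∣ S ∣ % 2 ℕP.≟ 0)
    odd = does (∣ S ∣ % 2 ℕP.≟ 1)
    distrib : ∀ a b c → (a -ℤ b) *ℤ c ≡ c *ℤ a -ℤ c *ℤ b
    distrib = solve-∀

  coeff-inDegreeMonomial : coeff (W G D) mO ≡ sign E ⊥ *ℤ (ℤ.+ numEvenES G D O -ℤ ℤ.+ numOddES G D O)
  coeff-inDegreeMonomial = begin
    coeff (W G D) mO
      ≡⟨ coeff≡⟦⟧δ (W G D) mO ⟩
    ⟦ Wᴱ E ⟧ δ mO
      ≡⟨ ⟦Wᴱ⟧-expansion E (δ mO) ⟩
    ∑ Ss (λ S → sign E S *ℤ δ mO (choiceMonomial E S))
      ≡⟨ ∑-cong Ss signed-δ ⟩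
    ∑ Ss (λ S → sign E ⊥ *ℤ (𝟙 (does (isEvenES? S)) -ℤ 𝟙 (does (isOddES? S))))
      ≡⟨ ∑-*ˡ (sign E ⊥) Ss _ ⟩
    sign E ⊥ *ℤ ∑ Ss (λ S → 𝟙 (does (isEvenES? S)) -ℤ 𝟙 (does (isOddES? S)))
      ≡⟨ cong (sign E ⊥ *ℤ_) (trans (∑-- Ss (𝟙 ∘ does ∘ isEvenES?) (𝟙 ∘ does ∘ isOddES?))
                                    (cong₂ _-ℤ_ (∑-𝟙 isEvenES? Ss) (∑-𝟙 isOddES? Ss))) ⟩
    sign E ⊥ *ℤ (ℤ.+ numEvenES G D O -ℤ ℤ.+ numOddES G D O) ∎
    where open ≡-Reasoning

  coeff-inDegreeMonomial≢0 : numEvenES G D O ≢ numOddES G D O → coeff (W G D) mO ≢ 0ℤ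
  coeff-inDegreeMonomial≢0 even≢odd c≡0 = even≢odd (ℤP.+-injective (ℤP.i-j≡0⇒i≡j _ _ difference≡0))
    where
    s = sign E ⊥
    x = ℤ.+ numEvenES G D O -ℤ ℤ.+ numOddES G D O
    difference≡0 : x ≡ 0ℤ
    difference≡0 = begin
      x                   ≡⟨ ℤP.*-identityˡ x ⟨
      1ℤ *ℤ x             ≡⟨ cong (_*ℤ x) (sign²≡1 E ⊥) ⟨
      (s *ℤ s) *ℤ x       ≡⟨ ℤP.*-assoc s s x ⟩
      s *ℤ (s *ℤ x)       ≡⟨ cong (s *ℤ_) (trans (sym coeff-inDegreeMonomial) c≡0) ⟩
      s *ℤ 0ℤ             ≡⟨ ℤP.*-zeroʳ s ⟩
      0ℤ                  ∎
      where open ≡-Reasoning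

maxExp-tabulate : (f : Fin n → ℕ) → maxExp (Vec.tabulate f) ≡ List.foldr _⊔_ 0 (List.map f (List.allFin n))
maxExp-tabulate {zero}  f = refl
maxExp-tabulate {suc n} f =
  trans (cong (f Fin.zero ⊔_) (maxExp-tabulate (f ∘ Fin.suc))) (sym (cong (List.foldr _⊔_ 0) (map-allFin-suc f)))
α-≤-cofactor : {p q : Poly n} {H : List (Monomial n)} {a b : ℕ} → p ≃ H ⋆ q →
               Homogeneous a p → Homogeneous b q → ∀ m → coeff p m ≢ 0ℤ → α q ≤ α p
α-≤-cofactor {p = p} {q} p≃ hp hq m c≢0
  with α-attained p m c≢0 (degP-homogeneous p hp m c≢0)
... | m* , c*≢0 , α≡ with ≃-support p≃ m* c*≢0
...   | m' , c'≢0 , h , hm'≡m* = begin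
  α q                ≤⟨ α-≤ q m' c'≢0 (degP-homogeneous q hq m' c'≢0) ⟩
  maxExp m'          ≤⟨ maxExp-*ᴹ h m' ⟩
  maxExp (h *ᴹ m')   ≡⟨ cong maxExp hm'≡m* ⟩
  maxExp m*          ≡⟨ α≡ ⟨
  α p                ∎
  where open ℕP.≤-Reasoning

module _ (G : SimpleGraph n) (D : Strength G) where

  W-homogeneous : Homogeneous (sum (List.map D (edges G))) (W G D)
  W-homogeneous = prodP-homogeneous _ D (λ e → binomial-homogeneous (endA G e) (endB G e) (D e)) (edges G)

  fG-homogeneous : Homogeneous (sum (List.map (λ _ → 1) (edges G))) (fG G)
  fG-homogeneous = prodP-homogeneous _ (λ _ → 1) (λ e → binomial-homogeneous (endA G e) (endB G e) 1) (edges G)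

  W≃fG : W G D ≃ List.foldr (_⊗_ ∘ λ e → geometricTerms (endA G e) (endB G e) (D e)) (1ᴹ ∷ []) (edges G)
               ⋆ fG G
  W≃fG = prodP-≃ _ _ _ (λ e → binomial-factor (endA G e) (endB G e) (D e)) (edges G)

lemma2p7 : ∀ {n} (G : SimpleGraph n) (O : Orientation G) (D : Strength G) →
           (∀ e → 1 ≤ D e) →
           numEvenES G D O ≢ numOddES G D O →
           (AT G ∸ 1 ≡ α (fG G)) × (α (fG G) ≤ α (W G D)) × (α (W G D) ≤ maxAugIn G D O)
lemma2p7 G O D _ even≢odd =
    ℕP.m+n∸n≡m (α (fG G)) 1
  , α-≤-cofactor (W≃fG G D) (W-homogeneous G D) (fG-homogeneous G D) mO c≢0
  , ℕP.≤-trans (α-≤ (W G D) mO c≢0 (degP-homogeneous (W G D) (W-homogeneous G D) mO c≢0))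
               (ℕP.≤-reflexive (maxExp-tabulate (augIn G D O ⊤)))
  where
  mO = inDegreeMonomial (augmentedOrientation G O D)
  c≢0 = coeff-inDegreeMonomial≢0 G O D even≢odd
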